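{- For every $n\ge3$, $\mathrm{bet}(n)\le 2\lceil\log_2 n\rceil$.
   Context: An ordering of $[n]$ is a bijection $\phi:[n]\to[n]$. A ternary constraint is a triple $(x_1,x_2,x_3)$ of distinct elements of $[n]$. $\phi$ between-satisfies the constraint if $\phi(x_1)<\phi(x_2)<\phi(x_3)$ or $\phi(x_3)<\phi(x_2)<\phi(x_1)$. $\mathrm{bet}(n)$ is the minimum size of a set of orderings of $[n]$ such that every ternary constraint is between-satisfied by some ordering in the set. -}

module Defs where

open import Data.Nat using (ℕ; _≤_)
open import Data.Fin using (Fin; _<_)
open import Data.Product using (Σ; ∃; _×_)
open import Data.Sum using (_⊎_)
open import Relation.Binary.PropositionalEquality using (_≢_)
open import Function.Bundles using (_↔_; Inverse)

Ordering : ℕ → Set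
Ordering n = Fin n ↔ Fin n

record Constraint (n : ℕ) : Set where
  constructor constraint
  field
    x₁ x₂ x₃ : Fin n
    d₁₂ : x₁ ≢ x₂
    d₁₃ : x₁ ≢ x₃
    d₂₃ : x₂ ≢ x₃

BetSat : ∀ {n} → Ordering n → Constraint n → Set
BetSat φ c =
  (f (x₁) < f (x₂) × f (x₂) < f (x₃)) ⊎ (f (x₃) < f (x₂) × f (x₂) < f (x₁))
  where
    open Constraint c
    f = Inverse.to φ

BetCover : (n m : ℕ) → Set
BetCover n m = Σ (Fin m → Ordering n) λ Φ →
  (c : Constraint n) → ∃ λ i → BetSat (Φ i) c

BetLE : (n k : ℕ) → Set
BetLE n k = ∃ λ m → m ≤ k × BetCover n m

module Submission where

-- Colour the points of [n] with two colours χ (say by one binary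
-- digit of each point).  For each of the two directions (ascending / descending) consider
-- the ordering that lists the colour-0 block first and the colour-1 block
-- second, each block sorted in that direction.  If a constraint (a, b, c)
-- has χ a ≠ χ c, then b is in the block of a or in the block of c, and one
-- of the two directions puts b on the correct side of the endpoint sharing
-- its block; so one of these two orderings between-satisfies (a, b, c).
-- With k colourings separating all pairs of points, 2k orderings therefore
-- cover every constraint; the k = ⌈log₂ n⌉ binary digits of 0 … n-1 separate.

open import Defs
open import Data.Nat using (ℕ; _≤_; _*_)
open import Data.Nat.Logarithm using (⌈log₂_⌉)

open import Data.Nat.Base using (zero; suc; parity; _+_; _^_; _<_; _<ᵇ_; ⌊_/2⌋; ⌈_/2⌉; s≤s; z≤n)
open import Data.Nat.Properties
open import Data.Nat.Logarithm.Core using (⌈log2⌉)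
open import Data.Nat.Induction using (<-wellFounded)
open import Induction.WellFounded using (Acc; acc)
open import Data.Parity.Base using (Parity; 0ℙ; 1ℙ)
open import Data.Parity.Properties using () renaming (_≟_ to _≟ℙ_)
open import Data.Bool.Properties using (T-≡)
open import Data.Fin.Base as F using (Fin; toℕ; fromℕ<; opposite; punchOut; combine; remQuot)
open import Data.Fin.Properties
  using (toℕ-fromℕ<; toℕ-injective; toℕ<n; any?; punchOut-injective; <⇒notInjective;
         opposite-prop; opposite-involutive; remQuot-combine)
  renaming (_≟_ to _≟F_)
open import Data.Fin.Subset using (Subset; _∈_; _⊂_; ⊤; ∣_∣)
open import Data.Fin.Subset.Properties using (p⊂q⇒∣p∣<∣q∣; ∈⊤; ∣⊤∣≡n)
open import Data.Vec.Base using (tabulate)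
open import Data.Vec.Properties using (lookup∘tabulate; []=⇒lookup; lookup⇒[]=)
open import Data.Product using (∃; _×_; _,_; proj₁; proj₂)
open import Data.Sum using (_⊎_; inj₁; inj₂)
open import Function using (id; _∘_)
open import Function.Bundles using (Equivalence; Inverse; mk↔ₛ′)
open import Function.Definitions using (Injective)
open import Relation.Nullary using (¬_; yes; no; contradiction)
open import Relation.Binary.Definitions using (tri<; tri≈; tri>)
open import Relation.Binary.PropositionalEquality

-- An injective endomap of Fin n is onto: if r were missed, squeezing r out
-- of the codomain would inject Fin n into Fin (n - 1).
injective⇒surjective : ∀ {n} (f : Fin n → Fin n) → Injective _≡_ _≡_ f →
                       ∀ r → ∃ λ x → f x ≡ r
injective⇒surjective {suc m} f f-inj r with any? (λ x → f x ≟F r)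
... | yes hit  = hit
... | no  miss = contradiction (λ {x} {y} → squeezed-injective {x} {y}) (<⇒notInjective (n<1+n m))
  where
    avoids : ∀ x → r ≢ f x
    avoids x r≡fx = miss (x , sym r≡fx)

    squeezed : Fin (suc m) → Fin m
    squeezed x = punchOut (avoids x)

    squeezed-injective : Injective _≡_ _≡_ squeezed
    squeezed-injective eq = f-inj (punchOut-injective (avoids _) (avoids _) eq)

injective⇒ordering : ∀ {n} (f : Fin n → Fin n) → Injective _≡_ _≡_ f → Ordering n
injective⇒ordering {n} f f-inj = mk↔ₛ′ f from (λ r → proj₂ (onto r)) (λ x → f-inj (proj₂ (onto (f x))))
  where
    onto : ∀ r → ∃ λ x → f x ≡ r
    onto = injective⇒surjective f f-inj

    from : Fin n → Fin n
    from r = proj₁ (onto r)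

module Ranking {n : ℕ} (g : Fin n → ℕ) where

  below : Fin n → Subset n
  below x = tabulate (λ y → g y <ᵇ g x)

  below-∈ : ∀ {x y} → g y < g x → y ∈ below x
  below-∈ {x} {y} gy<gx =
    lookup⇒[]= y _ (trans (lookup∘tabulate _ y) (Equivalence.to T-≡ (<⇒<ᵇ gy<gx)))

  ∈-below : ∀ {x y} → y ∈ below x → g y < g x
  ∈-below {x} {y} y∈ =
    <ᵇ⇒< _ _ (Equivalence.from T-≡ (trans (sym (lookup∘tabulate _ y)) ([]=⇒lookup y∈)))

  ∉-below-self : ∀ x → ¬ (x ∈ below x)
  ∉-below-self x x∈ = <-irrefl refl (∈-below x∈)

  below-⊂ : ∀ {x y} → g x < g y → below x ⊂ below y
  below-⊂ gx<gy = (λ z∈ → below-∈ (<-trans (∈-below z∈) gx<gy)) , _ , below-∈ gx<gy , ∉-below-self _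

  rank : Fin n → ℕ
  rank x = ∣ below x ∣

  -- below x misses x itself, so the rank is a valid position in [n].
  rank<n : ∀ x → rank x < n
  rank<n x = subst (rank x <_) (∣⊤∣≡n n) (p⊂q⇒∣p∣<∣q∣ ((λ _ → ∈⊤) , x , ∈⊤ , ∉-below-self x))

  rank-mono : ∀ {x y} → g x < g y → rank x < rank y
  rank-mono = p⊂q⇒∣p∣<∣q∣ ∘ below-⊂

  position : Fin n → Fin n
  position x = fromℕ< (rank<n x)

  position-mono : ∀ {x y} → g x < g y → position x F.< position y
  position-mono {x} {y} gx<gy =
    subst₂ _<_ (sym (toℕ-fromℕ< (rank<n x))) (sym (toℕ-fromℕ< (rank<n y))) (rank-mono gx<gy)

  position-injective : Injective _≡_ _≡_ g → Injective _≡_ _≡_ position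
  position-injective g-inj {x} {y} eq with <-cmp (g x) (g y)
  ... | tri< gx<gy _ _ = contradiction (cong toℕ eq) (<⇒≢ (position-mono gx<gy))
  ... | tri≈ _ gx≡gy _ = g-inj gx≡gy
  ... | tri> _ _ gy<gx = contradiction (cong toℕ (sym eq)) (<⇒≢ (position-mono gy<gx))

orderBy : ∀ {n} (g : Fin n → ℕ) → Injective _≡_ _≡_ g → Ordering n
orderBy g g-inj = injective⇒ordering position (position-injective g-inj)
  where open Ranking g

orderBy-mono : ∀ {n} (g : Fin n → ℕ) (g-inj : Injective _≡_ _≡_ g) {x y} →
               g x < g y → Inverse.to (orderBy g g-inj) x F.< Inverse.to (orderBy g g-inj) y
orderBy-mono g g-inj = position-mono
  where open Ranking g

module TwoBlocks {n : ℕ} (χ : Fin n → Parity) where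

  arrange : Fin 2 → Fin n → Fin n
  arrange F.zero         = id
  arrange (F.suc F.zero) = opposite

  arrange-injective : ∀ d → Injective _≡_ _≡_ (arrange d)
  arrange-injective F.zero         eq = eq
  arrange-injective (F.suc F.zero) {x} {y} eq =
    trans (sym (opposite-involutive x)) (trans (cong opposite eq) (opposite-involutive y))

  some-direction : ∀ {x y} → x ≢ y → ∃ λ d → arrange d x F.< arrange d y
  some-direction {x} {y} x≢y with <-cmp (toℕ x) (toℕ y)
  ... | tri< x<y _ _ = F.zero , x<y
  ... | tri≈ _ x≡y _ = contradiction (toℕ-injective x≡y) x≢y
  ... | tri> _ _ y<x = F.suc F.zero , subst₂ _<_ (sym (opposite-prop x)) (sym (opposite-prop y))
                                        (∸-monoʳ-< (s≤s y<x) (toℕ<n x))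

  -- Colour-0 points occupy places 0 … n-1, colour-1 points n … 2n-1.
  offset : Parity → ℕ
  offset 0ℙ = 0
  offset 1ℙ = n

  lower<upper : ∀ (s t : Fin n) → offset 0ℙ + toℕ s < offset 1ℙ + toℕ t
  lower<upper s t = <-≤-trans (toℕ<n s) (m≤m+n n (toℕ t))

  place-injective : ∀ p q (s t : Fin n) → offset p + toℕ s ≡ offset q + toℕ t → s ≡ t
  place-injective 0ℙ 0ℙ s t eq = toℕ-injective eq
  place-injective 1ℙ 1ℙ s t eq = toℕ-injective (+-cancelˡ-≡ n _ _ eq)
  place-injective 0ℙ 1ℙ s t eq = contradiction eq (<⇒≢ (lower<upper s t))
  place-injective 1ℙ 0ℙ s t eq = contradiction (sym eq) (<⇒≢ (lower<upper t s))

  key : Fin 2 → Fin n → ℕ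
  key d x = offset (χ x) + toℕ (arrange d x)

  key-injective : ∀ d → Injective _≡_ _≡_ (key d)
  key-injective d {x} {y} eq = arrange-injective d (place-injective (χ x) (χ y) _ _ eq)

  key-cross : ∀ d {x y} → χ x ≡ 0ℙ → χ y ≡ 1ℙ → key d x < key d y
  key-cross d {x} {y} χx χy =
    subst₂ (λ p q → offset p + toℕ (arrange d x) < offset q + toℕ (arrange d y)) (sym χx) (sym χy)
           (lower<upper (arrange d x) (arrange d y))

  key-same : ∀ d {x y} → χ x ≡ χ y → arrange d x F.< arrange d y → key d x < key d y
  key-same d {x} {y} χx≡χy lt =
    subst (λ p → offset p + toℕ (arrange d x) < key d y) (sym χx≡χy) (+-monoʳ-< (offset (χ y)) lt)

  ordering : Fin 2 → Ordering n
  ordering d = orderBy (key d) (key-injective d)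

  ordering-mono : ∀ d {x y} → key d x < key d y →
                  Inverse.to (ordering d) x F.< Inverse.to (ordering d) y
  ordering-mono d = orderBy-mono (key d) (key-injective d)

  -- Case split on a colour without abstracting it in the goal.
  colour-cases : ∀ p → p ≡ 0ℙ ⊎ p ≡ 1ℙ
  colour-cases 0ℙ = inj₁ refl
  colour-cases 1ℙ = inj₂ refl

  between : ∀ {a b c} → χ a ≡ 0ℙ → χ c ≡ 1ℙ → a ≢ b → b ≢ c →
            ∃ λ d → key d a < key d b × key d b < key d c
  between {a} {b} {c} χa χc a≢b b≢c with colour-cases (χ b)
  ... | inj₁ χb = let d , a<b = some-direction a≢b in
                  d , key-same d (trans χa (sym χb)) a<b , key-cross d χb χc
  ... | inj₂ χb = let d , b<c = some-direction b≢c in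
                  d , key-cross d χa χb , key-same d (trans χb (sym χc)) b<c

  between-satisfied : (con : Constraint n) → χ (Constraint.x₁ con) ≢ χ (Constraint.x₃ con) →
                      ∃ λ d → BetSat (ordering d) con
  between-satisfied (constraint a b c a≢b _ b≢c) χa≢χc with colour-cases (χ a) | colour-cases (χ c)
  ... | inj₁ χa | inj₁ χc = contradiction (trans χa (sym χc)) χa≢χc
  ... | inj₂ χa | inj₂ χc = contradiction (trans χa (sym χc)) χa≢χc
  ... | inj₁ χa | inj₂ χc = let d , a<b , b<c = between χa χc a≢b b≢c in
                            d , inj₁ (ordering-mono d a<b , ordering-mono d b<c)
  ... | inj₂ χa | inj₁ χc = let d , c<b , b<a = between χc χa (b≢c ∘ sym) (a≢b ∘ sym) in
                            d , inj₂ (ordering-mono d c<b , ordering-mono d b<a)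

separating⇒cover : ∀ {n k} (χ : Fin k → Fin n → Parity) →
                   (∀ {a c} → a ≢ c → ∃ λ j → χ j a ≢ χ j c) →
                   BetCover n (2 * k)
separating⇒cover {n} {k} χ separates = Φ , covers
  where
    blockOrdering : Fin 2 × Fin k → Ordering n
    blockOrdering (d , j) = TwoBlocks.ordering (χ j) d

    Φ : Fin (2 * k) → Ordering n
    Φ i = blockOrdering (remQuot k i)

    covers : (con : Constraint n) → ∃ λ i → BetSat (Φ i) con
    covers con with separates (Constraint.d₁₃ con)
    ... | j , differ with TwoBlocks.between-satisfied (χ j) con differ
    ... | d , sat = combine d j , subst (λ p → BetSat (blockOrdering p) con) (sym (remQuot-combine d j)) sat

digit : ℕ → ℕ → Parity
digit zero    a = parity a
digit (suc j) a = digit j ⌊ a /2⌋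

parity-half-injective : ∀ {a c} → parity a ≡ parity c → ⌊ a /2⌋ ≡ ⌊ c /2⌋ → a ≡ c
parity-half-injective {0}           {0}           _ _ = refl
parity-half-injective {1}           {1}           _ _ = refl
parity-half-injective {suc (suc a)} {suc (suc c)} p h = cong (suc ∘ suc) (parity-half-injective p (suc-injective h))
parity-half-injective {0}           {1}           () _
parity-half-injective {1}           {0}           () _
parity-half-injective {0}           {suc (suc c)} _ ()
parity-half-injective {1}           {suc (suc c)} _ ()
parity-half-injective {suc (suc a)} {0}           _ ()
parity-half-injective {suc (suc a)} {1}           _ ()

half-< : ∀ {a} x → a < 2 * x → ⌊ a /2⌋ < x
half-< {a} x a<2x = subst (suc ⌊ a /2⌋ ≤_) (sym (n≡⌈n+n/2⌉ x))
  (⌊n/2⌋-mono (s≤s (subst (a <_) (cong (x +_) (+-identityʳ x)) a<2x)))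

digits-separate : ∀ k {a c} → a < 2 ^ k → c < 2 ^ k → a ≢ c →
                  ∃ λ (j : Fin k) → digit (toℕ j) a ≢ digit (toℕ j) c
digits-separate zero    (s≤s z≤n) (s≤s z≤n) a≢c = contradiction refl a≢c
digits-separate (suc k) {a} {c} a< c< a≢c with parity a ≟ℙ parity c
... | no  parities-differ = F.zero , parities-differ
... | yes same-parity =
  let j , differ = digits-separate k (half-< _ a<) (half-< _ c<)
                                     (a≢c ∘ parity-half-injective same-parity)
  in F.suc j , differ

n≤2^⌈log2⌉ : ∀ n (rec : Acc _<_ n) → n ≤ 2 ^ ⌈log2⌉ n rec
n≤2^⌈log2⌉ zero          _        = z≤n
n≤2^⌈log2⌉ (suc zero)    _        = s≤s z≤n
n≤2^⌈log2⌉ (suc (suc m)) (acc rs) = begin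
  2 + m                          ≤⟨ +-monoʳ-≤ 2 m≤2⌈m/2⌉ ⟩
  2 + 2 * ⌈ m /2⌉                ≡⟨ *-suc 2 ⌈ m /2⌉ ⟨
  2 * suc ⌈ m /2⌉                ≤⟨ *-monoʳ-≤ 2 (n≤2^⌈log2⌉ (suc ⌈ m /2⌉) _) ⟩
  2 * 2 ^ ⌈log2⌉ (suc ⌈ m /2⌉) _ ∎
  where
    open ≤-Reasoning

    m≤2⌈m/2⌉ : m ≤ 2 * ⌈ m /2⌉
    m≤2⌈m/2⌉ = begin
      m                 ≡⟨ ⌊n/2⌋+⌈n/2⌉≡n m ⟨
      ⌊ m /2⌋ + ⌈ m /2⌉ ≤⟨ +-monoˡ-≤ ⌈ m /2⌉ (⌊n/2⌋≤⌈n/2⌉ m) ⟩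
      ⌈ m /2⌉ + ⌈ m /2⌉ ≡⟨ cong (⌈ m /2⌉ +_) (+-identityʳ ⌈ m /2⌉) ⟨
      2 * ⌈ m /2⌉       ∎

lemma3p2 : (n : ℕ) → 3 ≤ n → BetLE n (2 * ⌈log₂ n ⌉)
lemma3p2 n _ = 2 * k , ≤-refl , separating⇒cover bitColouring separates
  where
    k : ℕ
    k = ⌈log₂ n ⌉

    n≤2^k : n ≤ 2 ^ k
    n≤2^k = n≤2^⌈log2⌉ n (<-wellFounded n)

    bitColouring : Fin k → Fin n → Parity
    bitColouring j x = digit (toℕ j) (toℕ x)

    separates : ∀ {a c} → a ≢ c → ∃ λ j → bitColouring j a ≢ bitColouring j c
    separates {a} {c} a≢c = digits-separate k (<-≤-trans (toℕ<n a) n≤2^k) (<-≤-trans (toℕ<n c) n≤2^k)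
                                             (a≢c ∘ toℕ-injective)
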